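{- Let $t\ge 2$, $A=\{0,1,\ldots,t-1\}$, let $s>1$ be an integer, and let $P$ be a preference function of span $s-1$ whose induced least preference function $g:A^{s-1}\to A^{s-1}$ satisfies $g(0^{s-1})=0^{s-1}$ and admits no other cycles, i.e. for every $x\in A^{s-1}$ with $x\ne 0^{s-1}$ there is no $k\ge1$ with $g^k(x)=x$. Then for every integer $n\ge s$, the sequence produced by Algorithm P (with inputs $s$, $n$, $P$) is a de Bruijn sequence of order $n$.
   Context: A de Bruijn sequence of order $n$ over $A$ is a finite sequence of $t^n+n-1$ symbols of $A$ in which every word of length $n$ over $A$ appears exactly once as a block of contiguous symbols. A preference function $P$ of span $s-1$ assigns to each $\mathbf a\in A^{s-1}$ a vector $(P_1(\mathbf a),\ldots,P_t(\mathbf a))$ whose entries form a permutation of $A$. Its least preference function is $g(a_1,\ldots,a_{s-1})=(a_2,\ldots,a_{s-1},P_t(a_1,\ldots,a_{s-1}))$. $0^m$ denotes the word of $m$ zeros. Algorithm P (inputs $s>1$, $n\ge s$, $P$ of span $s-1$) produces a finite sequence $(a_i)$: $a_1=\cdots=a_n=0$; if $a_{N+1},\ldots,a_{N+n-1}$ have been defined (starting with $N=1$), set $a_{N+n}=P_i(a_{N+n-s+1},\ldots,a_{N+n-1})$ where $i\in\{1,\ldots,t\}$ is the smallest index such that the word $(a_{N+1},\ldots,a_{N+n-1},P_i(a_{N+n-s+1},\ldots,a_{N+n-1}))$ has not previously appeared as a block of contiguous symbols of the sequence; if no such $i$ exists, the sequence ends at $a_{N+n-1}$. -}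

module Defs where

open import Data.Nat using (ℕ; zero; suc; _+_; _∸_; _^_; _≤_)
open import Data.Fin using (Fin; zero; suc; fromℕ)
import Data.Fin.Properties as FinP
open import Data.List as List using (List; []; _∷_; _++_; [_]; length; take; drop; reverse; allFin)
open import Data.Vec as Vec using (Vec; []; _∷_; _∷ʳ_; lookup; replicate; toList)
open import Data.Maybe using (Maybe; just; nothing)
open import Data.Product using (Σ; ∃; ∃!; _×_; _,_)
open import Relation.Binary.PropositionalEquality using (_≡_; _≢_)
open import Relation.Nullary using (Dec; yes; no; ¬_)
open import Function.Definitions using (Injective)
open import Data.List.Relation.Binary.Infix.Heterogeneous using (Infix)
open import Data.List.Relation.Binary.Infix.Heterogeneous.Properties using (infix?)

-- A preference function of span m: to each a ∈ A^m it assigns a vector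
-- (P_1(a),...,P_t(a)) whose entries form a permutation of A
-- (t pairwise distinct entries from the t-element set A).
-- Entry P_i(a) is  lookup (P a) (i-1).
IsPreferenceFunction : (t m : ℕ) → (Vec (Fin t) m → Vec (Fin t) t) → Set
IsPreferenceFunction t m P = ∀ a → Injective _≡_ _≡_ (lookup (P a))

leastPref : ∀ {u m} → (Vec (Fin (suc u)) m → Vec (Fin (suc u)) (suc u))
          → Vec (Fin (suc u)) m → Fin (suc u)
leastPref {u} P a = lookup (P a) (fromℕ u)

leastPrefFun : ∀ {u m} → (Vec (Fin (suc u)) m → Vec (Fin (suc u)) (suc u))
             → Vec (Fin (suc u)) m → Vec (Fin (suc u)) m
leastPrefFun P [] = []
leastPrefFun P (a ∷ as) = as ∷ʳ leastPref P (a ∷ as)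

iter : ∀ {X : Set} → (X → X) → ℕ → X → X
iter f zero x = x
iter f (suc k) x = f (iter f k x)

zeros : ∀ {t m} → Vec (Fin (suc t)) m
zeros = replicate _ zero

-- The first k symbols of a list as a vector (padded with 0 if the list is
-- too short; this never happens in the algorithm, where the sequence always
-- has length ≥ n ≥ s > s-1).
takeV : ∀ {u} (k : ℕ) → List (Fin (suc u)) → Vec (Fin (suc u)) k
takeV zero _ = []
takeV (suc k) [] = zero ∷ takeV k []
takeV (suc k) (x ∷ xs) = x ∷ takeV k xs

lastV : ∀ {u} (k : ℕ) → List (Fin (suc u)) → Vec (Fin (suc u)) k
lastV k xs = Vec.reverse (takeV k (reverse xs))

lastL : ∀ {X : Set} (k : ℕ) → List X → List X
lastL k xs = drop (length xs ∸ k) xs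

IsBlock : ∀ {t} → List (Fin t) → List (Fin t) → Set
IsBlock w xs = Infix _≡_ w xs

isBlock? : ∀ {t} (w xs : List (Fin t)) → Dec (IsBlock w xs)
isBlock? w xs = infix? FinP._≟_ w xs

firstNew : ∀ {t} → List (Fin t) → List (Fin t) → List (Fin t) → Maybe (Fin t)
firstNew w xs [] = nothing
firstNew w xs (c ∷ cs) with isBlock? (w ++ [ c ]) xs
... | yes _ = firstNew w xs cs
... | no  _ = just c

stepP : ∀ {u} (s n : ℕ) (P : Vec (Fin (suc u)) (s ∸ 1) → Vec (Fin (suc u)) (suc u))
      → List (Fin (suc u)) → Maybe (List (Fin (suc u)))
stepP {u} s n P xs with firstNew (lastL (n ∸ 1) xs) xs
                                 (List.map (lookup (P (lastV (s ∸ 1) xs))) (allFin (suc u)))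
... | nothing = nothing
... | just c  = just (xs ++ [ c ])

reachesIn : ∀ {u} (s n : ℕ) (P : Vec (Fin (suc u)) (s ∸ 1) → Vec (Fin (suc u)) (suc u))
          → ℕ → List (Fin (suc u)) → Set
reachesIn s n P zero xs = xs ≡ toList (zeros {m = n})
reachesIn s n P (suc k) xs =
  ∃ λ ys → reachesIn s n P k ys × stepP s n P ys ≡ just xs

ProducedBy : ∀ {u} (s n : ℕ) (P : Vec (Fin (suc u)) (s ∸ 1) → Vec (Fin (suc u)) (suc u))
           → List (Fin (suc u)) → Set
ProducedBy s n P xs = (∃ λ k → reachesIn s n P k xs) × stepP s n P xs ≡ nothing

-- w occurs as a block of xs starting at position i (0-based)
OccursAt : ∀ {X : Set} → List X → List X → ℕ → Set
OccursAt w xs i = i + length w ≤ length xs × take (length w) (drop i xs) ≡ w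

IsDeBruijn : (t n : ℕ) → List (Fin t) → Set
IsDeBruijn t n xs =
  length xs ≡ t ^ n + n ∸ 1 ×
  (∀ (w : Vec (Fin t) n) → ∃! _≡_ (OccursAt (toList w) xs))

module Submission where

-- Write s = k + 2 and n = m + 1 with k + 1 ≤ m.  A "window" is a word of
-- length m; the next symbol is chosen from the preference vector of the
-- last k + 1 symbols, and lp w denotes the least preferred symbol after w.
--
--  1. Along the run an invariant holds: the sequence starts with 0^n, its
--     n-blocks occur at pairwise distinct positions, and for a window
--     w ≠ 0^m, if w·lp(w) occurs then every extension w·c occurs (the least
--     preferred symbol is used only after all others).
--  2. Distinct n-blocks bound the length by t^n + n - 1, so the run stops;
--     at that point every extension of the last window occurs.
--  3. Counting predecessors (in-degree = out-degree) shows that the last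
--     window is 0^m, that 0^m is preceded by every symbol, and that every
--     window v ≠ 0^m with all t extensions is preceded by every symbol.
--  4. The window map G(a·w) = w·lp(a·w) follows g on the last k + 1
--     symbols, and g drives every word to 0^(k+1), so G drives every window
--     to 0^m.  By 1 and 3, a window missing an extension passes this defect
--     to G of it; as 0^m misses none, every n-word occurs, exactly once by 1,
--     and counting positions gives the length.

open import Defs
open import Data.Nat using (ℕ; zero; suc; _+_; _∸_; _^_; _≤_; _<_; z≤n; s≤s; _⊓_; _<?_)
open import Data.Nat.Properties
open import Data.Fin as Fin using (Fin; zero; suc; fromℕ; toℕ; combine; remQuot; punchOut)
import Data.Fin.Properties as FinP
open import Data.List as List using (List; []; _∷_; _++_; [_]; length; take; drop; reverse; allFin)
import Data.List.Properties as ListP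
open import Data.Vec as Vec using (Vec; []; _∷_; _∷ʳ_; lookup; toList)
import Data.Vec.Properties as VecP
open import Data.Vec.Relation.Binary.Equality.Cast using (cast-is-id)
open import Data.Maybe using (just; nothing)
open import Data.Maybe.Properties using (just-injective)
open import Data.Product using (Σ; ∃; _×_; _,_; proj₁; proj₂)
open import Data.Sum using (_⊎_; inj₁; inj₂)
open import Data.Empty using (⊥; ⊥-elim)
open import Function using (_∘_)
open import Function.Definitions using (Injective)
open import Relation.Binary.PropositionalEquality hiding ([_])
open import Relation.Nullary using (Dec; yes; no; ¬_)
open import Data.List.Relation.Binary.Infix.Heterogeneous using (Infix; here; there)
open import Data.List.Relation.Binary.Prefix.Heterogeneous using (Prefix; []; _∷_)

module _ {A : Set} where

  Occurs : List A → List A → Set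
  Occurs w xs = ∃ λ i → OccursAt w xs i

  occursAt-unique : ∀ {v w : List A} {xs i} → length v ≡ length w →
                    OccursAt v xs i → OccursAt w xs i → v ≡ w
  occursAt-unique {xs = xs} {i} e (_ , p) (_ , q) =
    trans (sym p) (trans (cong (λ l → take l (drop i xs)) e) q)

  occursAt-∷⁻ : ∀ {w : List A} {x xs i} → OccursAt w (x ∷ xs) (suc i) → OccursAt w xs i
  occursAt-∷⁻ (s≤s h , e) = h , e

  occursAt-∷⁺ : ∀ {w : List A} {x xs i} → OccursAt w xs i → OccursAt w (x ∷ xs) (suc i)
  occursAt-∷⁺ (h , e) = s≤s h , e

  symbolAt : A → List A → ℕ → A
  symbolAt d [] _ = d
  symbolAt d (x ∷ xs) zero = x
  symbolAt d (x ∷ xs) (suc i) = symbolAt d xs i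

  occursAt-extendˡ : ∀ d {v : List A} xs i → OccursAt v xs (suc i) →
                     OccursAt (symbolAt d xs i ∷ v) xs i
  occursAt-extendˡ d [] i (() , _)
  occursAt-extendˡ d (x ∷ xs) zero (s≤s h , e) = s≤s h , cong (x ∷_) e
  occursAt-extendˡ d (x ∷ xs) (suc i) o =
    occursAt-∷⁺ {x = x} (occursAt-extendˡ d xs i (occursAt-∷⁻ {x = x} {xs = xs} o))

  occursAt-prefix : ∀ (v y : List A) {xs i} → OccursAt (v ++ y) xs i → OccursAt v xs i
  occursAt-prefix v y {xs} {i} (h , e) =
    ≤-trans (+-monoʳ-≤ i (ListP.length-++-≤ˡ v)) h , take-prefix v (drop i xs) e
    where
    take-prefix : ∀ (v zs : List A) → take (length (v ++ y)) zs ≡ v ++ y → take (length v) zs ≡ v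
    take-prefix [] zs e = refl
    take-prefix (a ∷ v) [] ()
    take-prefix (a ∷ v) (z ∷ zs) e =
      cong₂ _∷_ (ListP.∷-injectiveˡ e) (take-prefix v zs (ListP.∷-injectiveʳ e))

  take-++ˡ : ∀ l (xs ys : List A) → l ≤ length xs → take l (xs ++ ys) ≡ take l xs
  take-++ˡ zero xs ys h = refl
  take-++ˡ (suc l) (x ∷ xs) ys (s≤s h) = cong (x ∷_) (take-++ˡ l xs ys h)

  drop-++ˡ : ∀ i (xs ys : List A) → i ≤ length xs → drop i (xs ++ ys) ≡ drop i xs ++ ys
  drop-++ˡ zero xs ys h = refl
  drop-++ˡ (suc i) (x ∷ xs) ys (s≤s h) = drop-++ˡ i xs ys h

  block-++ : ∀ l i (xs ys : List A) → i + l ≤ length xs →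
             take l (drop i (xs ++ ys)) ≡ take l (drop i xs)
  block-++ l i xs ys h = trans (cong (take l) (drop-++ˡ i xs ys (≤-trans (m≤m+n i l) h)))
    (take-++ˡ l (drop i xs) ys
      (subst (l ≤_) (sym (ListP.length-drop i xs)) (m+n≤o⇒m≤o∸n l (subst (_≤ length xs) (+-comm i l) h))))

  occursAt-++ : ∀ {v : List A} {xs} ys {i} → OccursAt v xs i → OccursAt v (xs ++ ys) i
  occursAt-++ {v} {xs} ys {i} (h , e) =
    ≤-trans h (ListP.length-++-≤ˡ xs) , trans (block-++ (length v) i xs ys h) e

  length-snoc : ∀ (xs : List A) c → length (xs ++ [ c ]) ≡ suc (length xs)
  length-snoc xs c = trans (ListP.length-++ xs) (+-comm (length xs) 1)

  occursAt-snoc : ∀ {v : List A} xs c {i} → 1 ≤ length v → OccursAt v (xs ++ [ c ]) i →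
                  OccursAt v xs i ⊎ (i + length v ≡ suc (length xs) × v ≡ drop i xs ++ [ c ])
  occursAt-snoc {v} xs c {i} v≥1 (h , e)
    with m≤n⇒m<n∨m≡n (subst (i + length v ≤_) (length-snoc xs c) h)
  ... | inj₁ (s≤s lt) = inj₁ (lt , trans (sym (block-++ (length v) i xs [ c ] lt)) e)
  ... | inj₂ eq = inj₂ (eq , trans (sym e)
        (trans (cong (take (length v)) (drop-++ˡ i xs [ c ] i≤L))
               (ListP.take-all (length v) (drop i xs ++ [ c ]) (≤-reflexive final-length))))
    where
    open ≡-Reasoning
    i≤L : i ≤ length xs
    i≤L = ≤-pred (subst (suc i ≤_) eq (subst (_≤ i + length v) (+-comm i 1) (+-monoʳ-≤ i v≥1)))
    final-length : length (drop i xs ++ [ c ]) ≡ length v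
    final-length = begin
      length (drop i xs ++ [ c ])  ≡⟨ length-snoc (drop i xs) c ⟩
      suc (length (drop i xs))     ≡⟨ cong suc (ListP.length-drop i xs) ⟩
      suc (length xs ∸ i)          ≡⟨ sym (+-∸-assoc 1 i≤L) ⟩
      suc (length xs) ∸ i          ≡⟨ cong (_∸ i) (sym eq) ⟩
      i + length v ∸ i             ≡⟨ m+n∸m≡n i (length v) ⟩
      length v                     ∎

  occurs⇒infix : ∀ (w xs : List A) i → OccursAt w xs i → Infix _≡_ w xs
  occurs⇒infix w xs zero o = here (prefix w xs o)
    where
    prefix : ∀ (w xs : List A) → OccursAt w xs 0 → Prefix _≡_ w xs
    prefix [] xs o = []
    prefix (a ∷ w) [] (() , _)
    prefix (a ∷ w) (x ∷ xs) (s≤s h , e) = sym (ListP.∷-injectiveˡ e) ∷ prefix w xs (h , ListP.∷-injectiveʳ e)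
  occurs⇒infix w [] (suc i) (() , _)
  occurs⇒infix w (x ∷ xs) (suc i) o = there (occurs⇒infix w xs i (occursAt-∷⁻ {x = x} o))

  infix⇒occurs : ∀ {w xs : List A} → Infix _≡_ w xs → Occurs w xs
  infix⇒occurs (here p) = 0 , prefix p
    where
    prefix : ∀ {w xs : List A} → Prefix _≡_ w xs → OccursAt w xs 0
    prefix [] = z≤n , refl
    prefix (refl ∷ p) = s≤s (proj₁ (prefix p)) , cong (_ ∷_) (proj₂ (prefix p))
  infix⇒occurs {xs = x ∷ xs} (there q) with infix⇒occurs q
  ... | i , o = suc i , occursAt-∷⁺ {x = x} o

  length-lastL : ∀ l (xs : List A) → l ≤ length xs → length (lastL l xs) ≡ l
  length-lastL l xs h = trans (ListP.length-drop (length xs ∸ l) xs) (m∸[m∸n]≡n h)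

  occursAt-lastL : ∀ l (xs : List A) → l ≤ length xs → OccursAt (lastL l xs) xs (length xs ∸ l)
  occursAt-lastL l xs h =
    ≤-reflexive (trans (cong (length xs ∸ l +_) (length-lastL l xs h)) (m∸n+n≡m h)) ,
    ListP.take-all _ (drop (length xs ∸ l) xs) ≤-refl

  length-block : ∀ l i (xs : List A) → i + l ≤ length xs → length (take l (drop i xs)) ≡ l
  length-block l i xs h = trans (ListP.length-take l (drop i xs))
    (trans (cong (l ⊓_) (ListP.length-drop i xs))
           (m≤n⇒m⊓n≡m (m+n≤o⇒m≤o∸n l (subst (_≤ length xs) (+-comm i l) h))))

  occursAt-block : ∀ l i (xs : List A) → i + l ≤ length xs → OccursAt (take l (drop i xs)) xs i
  occursAt-block l i xs h rewrite length-block l i xs h = h , refl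

occurs? : ∀ {t} (w xs : List (Fin t)) → Dec (Occurs w xs)
occurs? w xs with isBlock? w xs
... | yes b = yes (infix⇒occurs b)
... | no nb = no λ { (i , o) → nb (occurs⇒infix w xs i o) }

injective⇒surjective : ∀ {r} (f : Fin r → Fin r) → Injective _≡_ _≡_ f → ∀ y → ∃ λ x → f x ≡ y
injective⇒surjective f inj y with FinP.any? (λ x → f x FinP.≟ y)
... | yes p = p
injective⇒surjective {suc r} f inj y | no ¬p = ⊥-elim (FinP.<⇒notInjective ≤-refl f'-injective)
  where
  missed : ∀ x → y ≢ f x
  missed x e = ¬p (x , sym e)
  f' : Fin (suc r) → Fin r
  f' x = punchOut (missed x)
  f'-injective : Injective _≡_ _≡_ f'
  f'-injective e = inj (FinP.punchOut-injective (missed _) (missed _) e)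

module _ {t : ℕ} where

  encode : ∀ {k} → Vec (Fin t) k → Fin (t ^ k)
  encode [] = zero
  encode (a ∷ as) = combine a (encode as)

  decode : ∀ {k} → Fin (t ^ k) → Vec (Fin t) k
  decode {zero} _ = []
  decode {suc k} x = proj₁ (remQuot {t} (t ^ k) x) ∷ decode (proj₂ (remQuot {t} (t ^ k) x))

  encode-injective : ∀ {k} (a b : Vec (Fin t) k) → encode a ≡ encode b → a ≡ b
  encode-injective [] [] e = refl
  encode-injective (x ∷ a) (y ∷ b) e with FinP.combine-injective x (encode a) y (encode b) e
  ... | x≡y , ea≡eb = cong₂ _∷_ x≡y (encode-injective a b ea≡eb)

  encode-decode : ∀ {k} (x : Fin (t ^ k)) → encode (decode {k} x) ≡ x
  encode-decode {zero} zero = refl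
  encode-decode {suc k} x =
    trans (cong (combine q) (encode-decode {k} r)) (FinP.combine-remQuot {t} (t ^ k) x)
    where
    q : Fin t
    q = proj₁ (remQuot {t} (t ^ k) x)
    r : Fin (t ^ k)
    r = proj₂ (remQuot {t} (t ^ k) x)

  decode-injective : ∀ {k} (x y : Fin (t ^ k)) → decode {k} x ≡ decode y → x ≡ y
  decode-injective {k} x y e =
    trans (sym (encode-decode {k} x)) (trans (cong encode e) (encode-decode {k} y))

iter-+ : ∀ {X : Set} (f : X → X) d a x → iter f (d + a) x ≡ iter f d (iter f a x)
iter-+ f zero a x = refl
iter-+ f (suc d) a x = cong f (iter-+ f d a x)

iter-fixed : ∀ {X : Set} (f : X → X) {z} → f z ≡ z →
             ∀ {i x} → iter f i x ≡ z → ∀ j → iter f (j + i) x ≡ z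
iter-fixed f fz e zero = e
iter-fixed f fz e (suc j) = trans (cong f (iter-fixed f fz e j)) fz

-- If no word other than z lies on a cycle of g, every orbit of g reaches z:
-- among t^k + 1 iterates two coincide, and the repeated word is on a cycle.
orbit-reaches : ∀ {t k} (g : Vec (Fin t) k → Vec (Fin t) k) (z : Vec (Fin t) k) →
                (∀ x → x ≢ z → ∀ j → 1 ≤ j → iter g j x ≢ x) →
                ∀ x → ∃ λ i → iter g i x ≡ z
orbit-reaches {t} {k} g z acyclic x
  with FinP.pigeonhole (n<1+n (t ^ k)) (λ p → encode (iter g (toℕ p) x))
... | i , j , i<j , e = toℕ i , on-cycle
  where
  y : Vec (Fin t) k
  y = iter g (toℕ i) x
  d : ℕ
  d = toℕ j ∸ toℕ i
  cycle : iter g d y ≡ y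
  cycle = begin
    iter g d y                     ≡⟨ sym (iter-+ g d (toℕ i) x) ⟩
    iter g (d + toℕ i) x           ≡⟨ cong (λ l → iter g l x) (m∸n+n≡m (<⇒≤ i<j)) ⟩
    iter g (toℕ j) x               ≡⟨ sym (encode-injective _ _ e) ⟩
    y                              ∎
    where open ≡-Reasoning
  on-cycle : y ≡ z
  on-cycle with VecP.≡-dec FinP._≟_ y z
  ... | yes p = p
  ... | no y≢z = ⊥-elim (acyclic y y≢z d (m<n⇒0<n∸m i<j) cycle)

module _ {t : ℕ} where

  firstNew-just : ∀ {r} (w xs : List (Fin t)) (h : Fin r → Fin t) {c} →
                  firstNew w xs (List.tabulate h) ≡ just c →
                  ∃ λ i → c ≡ h i × ¬ IsBlock (w ++ [ h i ]) xs ×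
                          (∀ j → j Fin.< i → IsBlock (w ++ [ h j ]) xs)
  firstNew-just {zero} w xs h ()
  firstNew-just {suc r} w xs h e with isBlock? (w ++ [ h zero ]) xs
  ... | no new = zero , sym (just-injective e) , new , λ j ()
  ... | yes old with firstNew-just w xs (h ∘ suc) e
  ...   | i , c≡ , new , earlier =
          suc i , c≡ , new , λ { zero _ → old ; (suc j) (s≤s j<i) → earlier j j<i }

  firstNew-nothing : ∀ {r} (w xs : List (Fin t)) (h : Fin r → Fin t) →
                     firstNew w xs (List.tabulate h) ≡ nothing → ∀ j → IsBlock (w ++ [ h j ]) xs
  firstNew-nothing {suc r} w xs h e j with isBlock? (w ++ [ h zero ]) xs
  firstNew-nothing {suc r} w xs h () j | no _
  firstNew-nothing {suc r} w xs h e zero | yes old = old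
  firstNew-nothing {suc r} w xs h e (suc j) | yes old = firstNew-nothing w xs (h ∘ suc) e j

module _ {u : ℕ} where
  private
    F = Fin (suc u)

  takeV-++ : ∀ l (as bs : List F) → l ≤ length as → takeV l (as ++ bs) ≡ takeV l as
  takeV-++ zero as bs h = refl
  takeV-++ (suc l) (a ∷ as) bs (s≤s h) = cong (a ∷_) (takeV-++ l as bs h)

  lastV-++ : ∀ l (pre zs : List F) → l ≤ length zs → lastV l (pre ++ zs) ≡ lastV l zs
  lastV-++ l pre zs h = cong Vec.reverse (trans (cong (takeV l) (ListP.reverse-++ pre zs))
    (takeV-++ l (reverse zs) (reverse pre) (subst (l ≤_) (sym (ListP.length-reverse zs)) h)))

  lastV-lastL : ∀ l j (xs : List F) → l ≤ j → j ≤ length xs → lastV l (lastL j xs) ≡ lastV l xs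
  lastV-lastL l j xs l≤j j≤L = sym (trans (cong (lastV l) (sym (ListP.take++drop≡id (length xs ∸ j) xs)))
    (lastV-++ l (take (length xs ∸ j) xs) (lastL j xs) (subst (l ≤_) (sym (length-lastL j xs j≤L)) l≤j)))

  lastV-snoc : ∀ l (ys : List F) y → lastV (suc l) (ys ++ [ y ]) ≡ lastV l ys ∷ʳ y
  lastV-snoc l ys y = trans (cong (λ r → Vec.reverse (takeV (suc l) r)) (ListP.reverse-++ ys [ y ]))
                            (VecP.reverse-∷ y (takeV l (reverse ys)))

  toList-takeV : ∀ l (ys : List F) → l ≤ length ys → toList (takeV l ys) ≡ take l ys
  toList-takeV zero ys h = refl
  toList-takeV (suc l) (y ∷ ys) (s≤s h) = cong (y ∷_) (toList-takeV l ys h)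

  lastV-∷ : ∀ l (a : F) (ys : List F) → l ≤ length ys → ∃ λ b → lastV (suc l) (a ∷ ys) ≡ b ∷ lastV l ys
  lastV-∷ zero a ys h with lastV 1 (a ∷ ys)
  ... | b ∷ [] = b , refl
  lastV-∷ (suc l) a ys h with List.initLast ys
  lastV-∷ (suc l) a .[] () | List.[]
  lastV-∷ (suc l) a .(zs ++ [ z ]) h | zs List.∷ʳ′ z
    with lastV-∷ l a zs (≤-pred (subst (suc l ≤_) (length-snoc zs z) h))
  ... | b , e = b , trans (lastV-snoc (suc l) (a ∷ zs) z)
                          (trans (cong (_∷ʳ z) e) (cong (b ∷_) (sym (lastV-snoc l zs z))))

module AlgorithmP
  (u k : ℕ) (P : Vec (Fin (suc u)) (suc k) → Vec (Fin (suc u)) (suc u))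
  (P-pref : IsPreferenceFunction (suc u) (suc k) P)
  (g-zero : leastPrefFun P zeros ≡ zeros)
  (g-acyclic : ∀ (x : Vec (Fin (suc u)) (suc k)) → x ≢ zeros →
               ∀ (j : ℕ) → 1 ≤ j → iter (leastPrefFun P) j x ≢ x)
  (m : ℕ) (span≤m : suc k ≤ m) where

  t n : ℕ
  t = suc u
  n = suc m

  F : Set
  F = Fin t

  g : Vec F (suc k) → Vec F (suc k)
  g = leastPrefFun P

  0^ : ℕ → List F
  0^ j = List.replicate j zero

  0^-snoc : ∀ j → 0^ j ++ [ zero ] ≡ 0^ (suc j)
  0^-snoc zero = refl
  0^-snoc (suc j) = cong (zero ∷_) (0^-snoc j)

  pref : List F → F → F
  pref xs = lookup (P (lastV (suc k) xs))

  lp : List F → F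
  lp w = leastPref P (lastV (suc k) w)

  -- The least preferred symbol after 0^(k+1) is 0, since g(0^(k+1)) = 0^(k+1).
  lp-zero : leastPref P zeros ≡ zero
  lp-zero = VecP.∷ʳ-injectiveʳ zeros zeros (trans g-zero (sym (zeros-snoc k)))
    where
    zeros-snoc : ∀ j → Vec.replicate {A = F} j zero ∷ʳ zero ≡ zero ∷ Vec.replicate j zero
    zeros-snoc zero = refl
    zeros-snoc (suc j) = cong (zero ∷_) (zeros-snoc j)

  G : List F → List F
  G [] = []
  G (a ∷ w) = w ++ [ lp (a ∷ w) ]

  length-G : ∀ w → length w ≡ m → length (G w) ≡ m
  length-G [] e = e
  length-G (a ∷ w) e = trans (length-snoc w _) e

  length-iterG : ∀ j w → length w ≡ m → length (iter G j w) ≡ m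
  length-iterG zero w e = e
  length-iterG (suc j) w e = length-G (iter G j w) (length-iterG j w e)

  lastV-G : ∀ w → length w ≡ m → lastV (suc k) (G w) ≡ g (lastV (suc k) w)
  lastV-G [] e = ⊥-elim (<⇒≢ (≤-trans (s≤s z≤n) span≤m) e)
  lastV-G (a ∷ w) e with lastV-∷ k a w (≤-pred (subst (suc k ≤_) (sym e) span≤m))
  ... | b , eb rewrite eb = lastV-snoc k w (leastPref P (b ∷ lastV k w))

  lastV-iterG : ∀ j w → length w ≡ m → lastV (suc k) (iter G j w) ≡ iter g j (lastV (suc k) w)
  lastV-iterG zero w e = refl
  lastV-iterG (suc j) w e = trans (lastV-G (iter G j w) (length-iterG j w e)) (cong g (lastV-iterG j w e))

  -- G drives every window to 0^m: once its last k + 1 symbols reach 0^(k+1),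
  -- G only appends zeros, so m further steps fill the window with zeros.
  reaches-0^ : ∀ w → length w ≡ m → ∃ λ K → iter G K w ≡ 0^ m
  reaches-0^ w lw with orbit-reaches g zeros g-acyclic (lastV (suc k) w)
  ... | i , reached = m + i , exhausted (proj₂ (suffix-zeros m ≤-refl))
    where
    lp-iter : ∀ j → lp (iter G (j + i) w) ≡ zero
    lp-iter j = trans (cong (leastPref P)
      (trans (lastV-iterG (j + i) w lw) (iter-fixed g g-zero reached j))) lp-zero
    suffix-zeros : ∀ j → j ≤ m → ∃ λ pre → iter G (j + i) w ≡ pre ++ 0^ j
    suffix-zeros zero _ = iter G i w , sym (ListP.++-identityʳ _)
    suffix-zeros (suc j) j<m with suffix-zeros j (<⇒≤ j<m)
    ... | [] , e = ⊥-elim (<⇒≢ j<m (trans (sym (ListP.length-replicate j))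
                     (trans (cong length (sym e)) (length-iterG (j + i) w lw))))
    ... | p ∷ pre , e = pre , (begin
      G (iter G (j + i) w)            ≡⟨ cong G e ⟩
      (pre ++ 0^ j) ++ [ lp (p ∷ pre ++ 0^ j) ]
        ≡⟨ cong (λ c → (pre ++ 0^ j) ++ [ c ]) (trans (cong lp (sym e)) (lp-iter j)) ⟩
      (pre ++ 0^ j) ++ [ zero ]       ≡⟨ ListP.++-assoc pre (0^ j) [ zero ] ⟩
      pre ++ 0^ j ++ [ zero ]         ≡⟨ cong (pre ++_) (0^-snoc j) ⟩
      pre ++ 0^ (suc j)               ∎)
      where open ≡-Reasoning
    exhausted : ∀ {pre} → iter G (m + i) w ≡ pre ++ 0^ m → iter G (m + i) w ≡ 0^ m
    exhausted {[]} e = e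
    exhausted {p ∷ pre} e = ⊥-elim (<-irrefl refl (begin-strict
      m                           ≤⟨ m≤n+m m (length pre) ⟩
      length pre + m              <⟨ n<1+n _ ⟩
      suc (length pre + m)        ≡⟨ cong (λ l → suc (length pre + l)) (sym (ListP.length-replicate m)) ⟩
      suc (length pre + length (0^ m)) ≡⟨ cong suc (sym (ListP.length-++ pre)) ⟩
      length ((p ∷ pre) ++ 0^ m)  ≡⟨ cong length (sym e) ⟩
      length (iter G (m + i) w)   ≡⟨ length-iterG (m + i) w lw ⟩
      m                           ∎))
      where open ≤-Reasoning

  candidates : List F → List F
  candidates xs = List.map (pref xs) (allFin t)

  candidates-tabulate : ∀ xs → candidates xs ≡ List.tabulate (pref xs)
  candidates-tabulate xs = ListP.map-tabulate (λ x → x) (pref xs)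

  stepP-just : ∀ xs ys → stepP (suc (suc k)) n P xs ≡ just ys →
               ∃ λ c → firstNew (lastL m xs) xs (candidates xs) ≡ just c × ys ≡ xs ++ [ c ]
  stepP-just xs ys e with firstNew (lastL m xs) xs (candidates xs)
  stepP-just xs ys refl | just c = c , refl , refl
  stepP-just xs ys () | nothing

  stepP-nothing : ∀ xs → stepP (suc (suc k)) n P xs ≡ nothing →
                  firstNew (lastL m xs) xs (candidates xs) ≡ nothing
  stepP-nothing xs e with firstNew (lastL m xs) xs (candidates xs)
  stepP-nothing xs () | just c
  stepP-nothing xs e | nothing = refl

  Complete : List F → List F → Set
  Complete xs w = ∀ c → Occurs (w ++ [ c ]) xs

  record Invariant (xs : List F) : Set where
    field
      long : n ≤ length xs
      starts : OccursAt (0^ n) xs 0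
      distinct : ∀ v {i j} → length v ≡ n → OccursAt v xs i → OccursAt v xs j → i ≡ j
      least-last : ∀ w → length w ≡ m → w ≢ 0^ m → Occurs (w ++ [ lp w ]) xs → Complete xs w

  length-extension : ∀ (w : List F) c → length w ≡ m → length (w ++ [ c ]) ≡ n
  length-extension w c e = trans (length-snoc w c) (cong suc e)

  0^n-split : 0^ n ≡ 0^ m ++ [ zero ]
  0^n-split = sym (0^-snoc m)

  position-in-0^n : ∀ {i} → i + n ≤ length (0^ n) → i ≡ 0
  position-in-0^n {zero} h = refl
  position-in-0^n {suc i} h =
    ⊥-elim (<-irrefl refl (≤-trans (s≤s (m≤n+m n i)) (≤-trans h (≤-reflexive (ListP.length-replicate n)))))

  invariant-start : Invariant (0^ n)
  Invariant.long invariant-start = ≤-reflexive (sym (ListP.length-replicate n))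
  Invariant.starts invariant-start = ≤-refl , ListP.take-all _ (0^ n) ≤-refl
  Invariant.distinct invariant-start v lv (hi , _) (hj , _) =
    trans (position-in-0^n (subst (λ l → _ + l ≤ _) lv hi)) (sym (position-in-0^n (subst (λ l → _ + l ≤ _) lv hj)))
  Invariant.least-last invariant-start w lw w≢0 (i , o)
    with position-in-0^n {i} (subst (λ l → i + l ≤ _) (length-extension w _ lw) (proj₁ o))
  ... | refl = ⊥-elim (w≢0 (ListP.∷ʳ-injectiveˡ w (0^ m)
         (trans (occursAt-unique (trans (length-extension w _ lw) (sym (ListP.length-replicate n))) o
                  (Invariant.starts invariant-start)) 0^n-split)))

  module Step (xs : List F) (inv : Invariant xs) (c : F)
              (chosen : firstNew (lastL m xs) xs (candidates xs) ≡ just c) where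
    open Invariant inv

    L : ℕ
    L = length xs

    w ys : List F
    w = lastL m xs
    ys = xs ++ [ c ]

    m≤L : m ≤ L
    m≤L = ≤-trans (n≤1+n m) long

    occurs-++ : ∀ {v} → Occurs v xs → Occurs v ys
    occurs-++ (i , o) = i , occursAt-++ [ c ] o

    choice : ∃ λ i → c ≡ pref xs i × ¬ IsBlock (w ++ [ pref xs i ]) xs ×
                     (∀ j → j Fin.< i → IsBlock (w ++ [ pref xs j ]) xs)
    choice = firstNew-just w xs (pref xs) (trans (cong (firstNew w xs) (sym (candidates-tabulate xs))) chosen)

    i₀ : F
    i₀ = proj₁ choice

    c≡ : c ≡ pref xs i₀
    c≡ = proj₁ (proj₂ choice)

    earlier : ∀ j → j Fin.< i₀ → IsBlock (w ++ [ pref xs j ]) xs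
    earlier = proj₂ (proj₂ (proj₂ choice))

    new : ¬ Occurs (w ++ [ c ]) xs
    new (i , o) = proj₁ (proj₂ (proj₂ choice))
      (subst (λ d → IsBlock (w ++ [ d ]) xs) c≡ (occurs⇒infix _ xs i o))

    new-block : OccursAt (w ++ [ c ]) ys (L ∸ m)
    new-block = subst₂ (λ v i → OccursAt v ys i)
      (trans (cong (λ i → drop i ys) end) (drop-++ˡ (L ∸ m) xs [ c ] (m∸n≤m L m))) end
      (occursAt-lastL n ys (≤-trans long (≤-trans (n≤1+n L) (≤-reflexive (sym (length-snoc xs c))))))
      where
      end : length ys ∸ n ≡ L ∸ m
      end = cong (_∸ n) (length-snoc xs c)

    classify : ∀ v {i} → length v ≡ n → OccursAt v ys i → OccursAt v xs i ⊎ (v ≡ w ++ [ c ] × i ≡ L ∸ m)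
    classify v {i} lv o with occursAt-snoc xs c (subst (1 ≤_) (sym lv) (s≤s z≤n)) o
    ... | inj₁ old = inj₁ old
    ... | inj₂ (eq , v≡) = inj₂ (trans v≡ (cong (λ j → drop j xs ++ [ c ]) i≡) , i≡)
      where
      i≡ : i ≡ L ∸ m
      i≡ = trans (sym (m+n∸n≡m i m))
             (cong (_∸ m) (suc-injective (trans (sym (+-suc i m)) (trans (cong (i +_) (sym lv)) eq))))

    lp-w : lp w ≡ pref xs (fromℕ u)
    lp-w = cong (λ z → lookup (P z) (fromℕ u)) (lastV-lastL (suc k) m xs span≤m m≤L)

    chosen-least : lp w ≡ c → Complete ys w
    chosen-least lp≡c c' with injective⇒surjective (pref xs) (P-pref _) c'
    ... | j , j↦c' with j FinP.≟ fromℕ u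
    ...   | yes refl = L ∸ m ,
            subst (λ d → OccursAt (w ++ [ d ]) ys (L ∸ m)) (trans (sym lp≡c) (trans lp-w j↦c')) new-block
    ...   | no j≢last = occurs-++ (subst (λ d → Occurs (w ++ [ d ]) xs) j↦c'
            (infix⇒occurs (earlier j (subst (j Fin.<_) (sym i₀-last) (FinP.≤∧≢⇒< (FinP.≤fromℕ j) j≢last)))))
      where
      i₀-last : i₀ ≡ fromℕ u
      i₀-last = P-pref (lastV (suc k) xs) (trans (sym c≡) (trans (sym lp≡c) lp-w))

    invariant : Invariant ys
    Invariant.long invariant = ≤-trans long (≤-trans (n≤1+n L) (≤-reflexive (sym (length-snoc xs c))))
    Invariant.starts invariant = occursAt-++ {xs = xs} [ c ] {i = 0} starts
    Invariant.distinct invariant v lv oi oj with classify v lv oi | classify v lv oj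
    ... | inj₁ a | inj₁ b = distinct v lv a b
    ... | inj₂ (_ , a) | inj₂ (_ , b) = trans a (sym b)
    ... | inj₁ a | inj₂ (e , _) = ⊥-elim (new (_ , subst (λ z → OccursAt z xs _) e a))
    ... | inj₂ (e , _) | inj₁ b = ⊥-elim (new (_ , subst (λ z → OccursAt z xs _) e b))
    Invariant.least-last invariant w' lw' w'≢0 (i , o) with classify (w' ++ [ lp w' ]) (length-extension w' _ lw') o
    ... | inj₁ old = occurs-++ ∘ least-last w' lw' w'≢0 (i , old)
    ... | inj₂ (e , _) with ListP.∷ʳ-injective w' w e
    ...   | refl , lp≡c = chosen-least lp≡c

  invariant-step : ∀ xs ys → Invariant xs → stepP (suc (suc k)) n P xs ≡ just ys → Invariant ys
  invariant-step xs ys inv e with stepP-just xs ys e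
  ... | c , chosen , refl = Step.invariant xs inv c chosen

  T : ℕ
  T = t ^ n

  -- Pairwise distinct n-blocks: at most T of them, so the length is below T + n.
  length-bound : ∀ xs → Invariant xs → length xs < T + n
  length-bound xs inv with length xs <? T + n
  ... | yes p = p
  ... | no long with FinP.pigeonhole (n<1+n T) (λ p → encode (takeV n (drop (toℕ p) xs)))
  ...   | i , j , i<j , e = ⊥-elim (<-irrefl (Invariant.distinct inv (take n (drop (toℕ i) xs))
            (length-block n (toℕ i) xs (fits i)) (occursAt-block n (toℕ i) xs (fits i))
            (subst (λ v → OccursAt v xs (toℕ j)) (sym same-block) (occursAt-block n (toℕ j) xs (fits j)))) i<j)
    where
    fits : ∀ (p : Fin (suc T)) → toℕ p + n ≤ length xs
    fits p = ≤-trans (+-monoˡ-≤ n (≤-pred (FinP.toℕ<n p))) (≮⇒≥ long)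
    block≡ : ∀ p → toList (takeV n (drop (toℕ p) xs)) ≡ take n (drop (toℕ p) xs)
    block≡ p = toList-takeV n (drop (toℕ p) xs)
      (subst (n ≤_) (sym (ListP.length-drop (toℕ p) xs))
        (m+n≤o⇒m≤o∸n n (subst (_≤ length xs) (+-comm (toℕ p) n) (fits p))))
    same-block : take n (drop (toℕ i) xs) ≡ take n (drop (toℕ j) xs)
    same-block = trans (sym (block≡ i)) (trans (cong toList (encode-injective _ _ e)) (block≡ j))

  run-from : ∀ fuel xs → (∃ λ j → reachesIn (suc (suc k)) n P j xs) → Invariant xs →
             T + n ≤ length xs + fuel → Σ (List F) λ zs → ProducedBy (suc (suc k)) n P zs × Invariant zs
  run-from fuel xs reached inv enough with stepP (suc (suc k)) n P xs in step
  ... | nothing = xs , (reached , step) , inv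
  run-from zero xs reached inv enough | just ys =
    ⊥-elim (<⇒≱ (length-bound xs inv) (≤-trans enough (≤-reflexive (+-identityʳ _))))
  run-from (suc fuel) xs (j , rj) inv enough | just ys with stepP-just xs ys step
  ... | c , _ , refl = run-from fuel ys (suc j , xs , rj , step) (invariant-step xs ys inv step)
        (≤-trans enough (≤-reflexive (trans (+-suc _ fuel) (cong (_+ fuel) (sym (length-snoc xs c))))))

  run : Σ (List F) λ zs → ProducedBy (suc (suc k)) n P zs × Invariant zs
  run = run-from (T + n) (0^ n) (0 , sym (VecP.toList-replicate n zero)) invariant-start (m≤n+m (T + n) (length (0^ n)))

  module Final (xs : List F) (inv : Invariant xs) (stop : stepP (suc (suc k)) n P xs ≡ nothing) where
    open Invariant inv

    L : ℕ
    L = length xs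

    w₀ : List F
    w₀ = lastL m xs

    m≤L : m ≤ L
    m≤L = ≤-trans (n≤1+n m) long

    length-w₀ : length w₀ ≡ m
    length-w₀ = length-lastL m xs m≤L

    end-position : L ∸ m ≡ suc (L ∸ n)
    end-position = +-∸-assoc 1 long

    last-complete : Complete xs w₀
    last-complete c with injective⇒surjective (pref xs) (P-pref _) c
    ... | j , j↦c = subst (λ d → Occurs (w₀ ++ [ d ]) xs) j↦c (infix⇒occurs
          (firstNew-nothing w₀ xs (pref xs)
            (trans (cong (firstNew w₀ xs) (sym (candidates-tabulate xs))) (stepP-nothing xs stop)) j))

    not-at-end : ∀ {v p} → length v ≡ n → OccursAt v xs p → p ≢ L ∸ m
    not-at-end lv (h , _) refl = <-irrefl refl (begin-strict
      L                   ≡⟨ sym (m∸n+n≡m m≤L) ⟩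
      L ∸ m + m           <⟨ +-monoʳ-< (L ∸ m) (n<1+n m) ⟩
      L ∸ m + n           ≤⟨ subst (λ l → L ∸ m + l ≤ L) lv h ⟩
      L                   ∎)
      where open ≤-Reasoning

    occurs-later : ∀ {v p} → length v ≡ n → v ≢ 0^ n → OccursAt v xs p → ∃ λ r → p ≡ suc r
    occurs-later {p = zero} lv v≢0 o =
      ⊥-elim (v≢0 (occursAt-unique (trans lv (sym (ListP.length-replicate n))) o starts))
    occurs-later {p = suc r} _ _ _ = r , refl

    extension-nonzero : ∀ {v} → v ≢ 0^ m → ∀ c → v ++ [ c ] ≢ 0^ n
    extension-nonzero {v} v≢0 c e = v≢0 (ListP.∷ʳ-injectiveˡ v (0^ m) (trans e 0^n-split))

    record Preceded (v : List F) (r : ℕ) : Set where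
      field
        position : Fin r → ℕ
        position-injective : Injective _≡_ _≡_ position
        occurs-after : ∀ i → OccursAt v xs (suc (position i))

    -- Distinct n-blocks: the symbols preceding these occurrences are distinct.
    preceding-injective : ∀ {v r} → length v ≡ m → (pr : Preceded v r) →
                          Injective _≡_ _≡_ (symbolAt zero xs ∘ Preceded.position pr)
    preceding-injective {v} lv pr {i} {j} e = Preceded.position-injective pr
      (distinct (symbolAt zero xs (position i) ∷ v) (cong suc lv)
        (occursAt-extendˡ zero xs (position i) (occurs-after i))
        (subst (λ a → OccursAt (a ∷ v) xs (position j)) (sym e)
          (occursAt-extendˡ zero xs (position j) (occurs-after j))))
      where open Preceded pr

    preceded-by-all : ∀ {v} → length v ≡ m → Preceded v t → ∀ a → Occurs (a ∷ v) xs
    preceded-by-all {v} lv pr a with injective⇒surjective _ (preceding-injective lv pr) a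
    ... | i , i↦a = position i ,
          subst (λ b → OccursAt (b ∷ v) xs (position i)) i↦a (occursAt-extendˡ zero xs (position i) (occurs-after i))
      where open Preceded pr

    not-over-preceded : ∀ {v} → length v ≡ m → ¬ Preceded v (suc t)
    not-over-preceded lv pr = FinP.<⇒notInjective ≤-refl (preceding-injective lv pr)

    -- The occurrences of r distinct extensions v·e(i) (none equal to 0^n) give r
    -- distinct preceded occurrences of v; if v is the last window, its final
    -- occurrence gives one more.
    module Extensions {v} (lv : length v ≡ m) {r} (e : Fin r → F) (e-injective : Injective _≡_ _≡_ e)
                      (nonzero : ∀ i → v ++ [ e i ] ≢ 0^ n) (occ : ∀ i → Occurs (v ++ [ e i ]) xs) where

      later : ∀ i → ∃ λ p → proj₁ (occ i) ≡ suc p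
      later i = occurs-later (length-extension v (e i) lv) (nonzero i) (proj₂ (occ i))

      position : Fin r → ℕ
      position i = proj₁ (later i)

      extension-at : ∀ i → OccursAt (v ++ [ e i ]) xs (suc (position i))
      extension-at i = subst (OccursAt (v ++ [ e i ]) xs) (proj₂ (later i)) (proj₂ (occ i))

      position-injective : Injective _≡_ _≡_ position
      position-injective {i} {j} eq = e-injective (ListP.∷ʳ-injectiveʳ v v
        (occursAt-unique {xs = xs} (trans (length-snoc v (e i)) (sym (length-snoc v (e j))))
          (extension-at i) (subst (λ p → OccursAt (v ++ [ e j ]) xs (suc p)) (sym eq) (extension-at j))))

      position-not-end : ∀ i → position i ≢ L ∸ n
      position-not-end i eq =
        not-at-end (length-extension v (e i) lv) (extension-at i) (trans (cong suc eq) (sym end-position))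

      preceded : Preceded v r
      Preceded.position preceded = position
      Preceded.position-injective preceded = position-injective
      Preceded.occurs-after preceded i = occursAt-prefix v [ e i ] {xs = xs} (extension-at i)

      preceded-with-end : v ≡ w₀ → Preceded v (suc r)
      Preceded.position (preceded-with-end _) zero = L ∸ n
      Preceded.position (preceded-with-end _) (suc i) = position i
      Preceded.position-injective (preceded-with-end _) {zero} {zero} eq = refl
      Preceded.position-injective (preceded-with-end _) {zero} {suc j} eq = ⊥-elim (position-not-end j (sym eq))
      Preceded.position-injective (preceded-with-end _) {suc i} {zero} eq = ⊥-elim (position-not-end i eq)
      Preceded.position-injective (preceded-with-end _) {suc i} {suc j} eq = cong suc (position-injective eq)
      Preceded.occurs-after (preceded-with-end refl) zero = subst (OccursAt w₀ xs) end-position (occursAt-lastL m xs m≤L)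
      Preceded.occurs-after (preceded-with-end _) (suc i) = occursAt-prefix v [ e i ] {xs = xs} (extension-at i)

    -- The last window is 0^m: otherwise it would be preceded t + 1 times.
    last-window-zero : w₀ ≡ 0^ m
    last-window-zero with ListP.≡-dec FinP._≟_ w₀ (0^ m)
    ... | yes w₀≡0 = w₀≡0
    ... | no w₀≢0 = ⊥-elim (not-over-preceded length-w₀
            (Extensions.preceded-with-end length-w₀ (λ c → c) (λ eq → eq)
              (extension-nonzero w₀≢0) last-complete refl))

    zero-complete : Complete xs (0^ m)
    zero-complete = subst (Complete xs) last-window-zero last-complete

    -- 0^m is preceded by every symbol: its t extensions other than 0^n, and its final occurrence.
    zero-preceded : ∀ a → Occurs (a ∷ 0^ m) xs
    zero-preceded = preceded-by-all (ListP.length-replicate m)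
      (Extensions.preceded-with-end (ListP.length-replicate m) suc FinP.suc-injective nonzero
        (zero-complete ∘ suc) (sym last-window-zero))
      where
      nonzero : ∀ c → 0^ m ++ [ suc c ] ≢ 0^ n
      nonzero c e with ListP.∷ʳ-injectiveʳ (0^ m) (0^ m) (trans e 0^n-split)
      ... | ()

    -- In-degree equals out-degree: a complete window is preceded by every symbol.
    complete⇒preceded : ∀ v → length v ≡ m → Complete xs v → ∀ a → Occurs (a ∷ v) xs
    complete⇒preceded v lv complete with ListP.≡-dec FinP._≟_ v (0^ m)
    ... | yes refl = zero-preceded
    ... | no v≢0 = preceded-by-all lv
            (Extensions.preceded lv (λ c → c) (λ eq → eq) (extension-nonzero v≢0) complete)

    -- A window missing an extension passes the defect on to its G-image:
    -- if G(a·w) were complete, w·lp(a·w) = a·G(a·w) would occur, making a·w complete.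
    incomplete-G : ∀ w → length w ≡ m → ¬ Complete xs w → ¬ Complete xs (G w)
    incomplete-G w lw incomplete with ListP.≡-dec FinP._≟_ w (0^ m)
    ... | yes refl = ⊥-elim (incomplete zero-complete)
    incomplete-G [] lw incomplete | no _ = incomplete
    incomplete-G (a ∷ w) lw incomplete | no w≢0 = λ complete →
      incomplete (least-last (a ∷ w) lw w≢0 (complete⇒preceded (G (a ∷ w)) (length-G (a ∷ w) lw) complete a))

    -- Every window is complete, since iterating G reaches the complete window 0^m.
    every-window-complete : ∀ w → length w ≡ m → Complete xs w
    every-window-complete w lw c with occurs? (w ++ [ c ]) xs
    ... | yes found = found
    ... | no missing with reaches-0^ w lw
    ...   | K , reached = ⊥-elim (subst (λ v → ¬ Complete xs v) reached (incomplete-iter K) zero-complete)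
      where
      incomplete-iter : ∀ j → ¬ Complete xs (iter G j w)
      incomplete-iter zero complete = missing (complete c)
      incomplete-iter (suc j) = incomplete-G (iter G j w) (length-iterG j w lw) (incomplete-iter j)

    every-word-occurs : ∀ v → length v ≡ n → Occurs v xs
    every-word-occurs v lv with List.initLast v
    every-word-occurs .[] () | List.[]
    every-word-occurs .(w ++ [ c ]) lv | w List.∷ʳ′ c =
      every-window-complete w (suc-injective (trans (sym (length-snoc w c)) lv)) c

    T≤positions : T ≤ L ∸ m
    T≤positions = FinP.injective⇒≤ {f = position} position-injective
      where
      word : Fin T → List F
      word j = toList (decode {k = n} j)
      length-word : ∀ j → length (word j) ≡ n
      length-word j = VecP.length-toList (decode {k = n} j)
      found : ∀ j → Occurs (word j) xs
      found j = every-word-occurs (word j) (length-word j)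
      in-range : ∀ j → proj₁ (found j) < L ∸ m
      in-range j = m+n≤o⇒m≤o∸n (suc (proj₁ (found j))) (subst (_≤ L) (+-suc (proj₁ (found j)) m)
        (subst (λ l → proj₁ (found j) + l ≤ L) (length-word j) (proj₁ (proj₂ (found j)))))
      position : Fin T → Fin (L ∸ m)
      position j = Fin.fromℕ< (in-range j)
      word-injective : ∀ i j → word i ≡ word j → i ≡ j
      word-injective i j e = decode-injective {k = n} i j
        (trans (sym (cast-is-id refl (decode {k = n} i))) (VecP.toList-injective refl _ _ e))
      position-injective : Injective _≡_ _≡_ position
      position-injective {i} {j} eq = word-injective i j
        (occursAt-unique (trans (length-word i) (sym (length-word j)))
          (proj₂ (found i)) (subst (OccursAt (word j) xs) (sym same) (proj₂ (found j))))
        where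
        same : proj₁ (found i) ≡ proj₁ (found j)
        same = trans (sym (FinP.toℕ-fromℕ< (in-range i))) (trans (cong toℕ eq) (FinP.toℕ-fromℕ< (in-range j)))

    -- Counting: T ≤ L ∸ m from above and L < T + n from the length bound.
    length-exact : length xs ≡ T + n ∸ 1
    length-exact = begin
      L          ≡⟨ ≤-antisym (≤-pred (subst (L <_) (+-suc T m) (length-bound xs inv)))
                              (subst (T + m ≤_) (m∸n+n≡m m≤L) (+-monoˡ-≤ m T≤positions)) ⟩
      T + m      ≡⟨ cong (_∸ 1) (sym (+-suc T m)) ⟩
      T + n ∸ 1  ∎
      where open ≡-Reasoning

    is-de-Bruijn : IsDeBruijn t n xs
    is-de-Bruijn = length-exact , λ v →
      let lv = VecP.length-toList v
          (p , o) = every-word-occurs (toList v) lv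
      in p , o , λ o' → distinct (toList v) lv o o'

  produces-de-Bruijn : Σ (List F) λ xs → ProducedBy (suc (suc k)) n P xs × IsDeBruijn t n xs
  produces-de-Bruijn with run
  ... | xs , produced , inv = xs , produced , Final.is-de-Bruijn xs inv (proj₂ produced)

-- The theorem: instantiate AlgorithmP with s = k + 2 and n = m + 1.

mainTheorem3 : (u : ℕ) → 1 ≤ u → (s : ℕ) → 1 < s
    → (P : Vec (Fin (suc u)) (s ∸ 1) → Vec (Fin (suc u)) (suc u))
    → IsPreferenceFunction (suc u) (s ∸ 1) P
    → leastPrefFun P zeros ≡ zeros
    → (∀ (x : Vec (Fin (suc u)) (s ∸ 1)) → x ≢ zeros → ∀ (k : ℕ) → 1 ≤ k → iter (leastPrefFun P) k x ≢ x)
    → (n : ℕ) → s ≤ n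
    → Σ (List (Fin (suc u))) (λ xs → ProducedBy s n P xs × IsDeBruijn (suc u) n xs)
mainTheorem3 u _ (suc (suc k)) (s≤s (s≤s z≤n)) P P-pref g-zero g-acyclic (suc m) (s≤s span≤m) =
  AlgorithmP.produces-de-Bruijn u k P P-pref g-zero g-acyclic m span≤m
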